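{- Let $D$ be an eulerian digraph with $m$ arcs and $n$ vertices, in which exactly $\ell$ of the vertices have degree congruent to $0$ mod $4$. Let $T$ be a given directed euler circuit of $D$. Then there exists an orientable directed embedding of $D$ with one proface bounded by $T$ and at most $\ell+1$ antifaces. Consequently, the maximum genus of an orientable directed embedding of $D$ is at least $(m-n-\ell)/2$.
   Context: Digraphs are finite and may have loops and multiple arcs. The degree of a vertex in a digraph is its total degree (indegree plus outdegree). A digraph is eulerian if it has a directed circuit (closed directed trail) using every arc and every vertex; a directed euler circuit is such a circuit. All embeddings are cellular embeddings in closed surfaces. A directed embedding of a digraph is an embedding in which every face is bounded by a directed closed walk (respecting arc directions). In an orientable directed embedding with a fixed orientation of the surface, a face is a proface if its facial directed walk is clockwise and an antiface if it is anticlockwise. -}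

module Defs where

open import Data.Nat using (ℕ; zero; suc; _≤ᵇ_; _≡ᵇ_; _<?_; _%_)
open import Data.Fin using (Fin; toℕ; fromℕ<; _≟_)
import Data.Fin as F
open import Data.List using (List; length; filterᵇ; map; and; upTo; allFin)
open import Data.Bool using (Bool)
open import Data.Sum using (_⊎_)
open import Data.Product using (∃; _×_)
open import Data.Integer using (ℤ; +_; _-_; _+_)
open import Relation.Nullary using (yes; no)
open import Relation.Nullary.Decidable using (⌊_⌋)
open import Relation.Binary.PropositionalEquality using (_≡_)

record Digraph (n m : ℕ) : Set where
  field
    tail : Fin m → Fin n
    head : Fin m → Fin n
open Digraph public

-- total degree = outdegree + indegree (a loop contributes 2)
degree : ∀ {n m} → Digraph n m → Fin n → ℕ
degree {n} {m} D v =
  length (filterᵇ (λ a → ⌊ tail D a ≟ v ⌋) (allFin m))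
  Data.Nat.+ length (filterᵇ (λ a → ⌊ head D a ≟ v ⌋) (allFin m))

numDeg0mod4 : ∀ {n m} → Digraph n m → ℕ
numDeg0mod4 {n} D = length (filterᵇ (λ v → (degree D v % 4) ≡ᵇ 0) (allFin n))

cyc : ∀ {m} → Fin m → Fin m
cyc {suc k} i with suc (toℕ i) <? suc k
... | yes p = fromℕ< p
... | no _ = F.zero

iter : ∀ {A : Set} → (A → A) → ℕ → A → A
iter f zero x = x
iter f (suc k) x = f (iter f k x)

-- number of cycles (orbits) of a permutation f of Fin m:
-- count the elements that are the minimum of their orbit.
orbitCount : ∀ {m} → (Fin m → Fin m) → ℕ
orbitCount {m} f =
  length (filterᵇ (λ x → and (map (λ k → toℕ x ≤ᵇ toℕ (iter f k x)) (upTo m))) (allFin m))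

-- A directed euler circuit: a closed directed trail starting at 'start',
-- traversing the arcs in the order seq 0, seq 1, ..., seq (m-1), using
-- every arc exactly once (seq injective) and visiting every vertex.
record EulerCircuit {n m : ℕ} (D : Digraph n m) : Set where
  field
    start    : Fin n
    seq      : Fin m → Fin m
    seq-inj  : ∀ i j → seq i ≡ seq j → i ≡ j
    consec   : ∀ i → head D (seq i) ≡ tail D (seq (cyc i))
    startOk  : ∀ i → toℕ i ≡ 0 → tail D (seq i) ≡ start
    allVerts : ∀ v → v ≡ start ⊎ ∃ λ i → tail D (seq i) ≡ v
open EulerCircuit public

-- arc ends (darts): out a is the tail end of a, inn a is the head end of a
data Dart (m : ℕ) : Set where
  out : Fin m → Dart m
  inn : Fin m → Dart m

dartV : ∀ {n m} → Digraph n m → Dart m → Fin n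
dartV D (out a) = tail D a
dartV D (inn a) = head D a

arcOf : ∀ {m} → Dart m → Fin m
arcOf (out a) = a
arcOf (inn a) = a

-- An orientable directed embedding, given by a rotation system:
-- ρ is a permutation of the darts whose cycles are exactly the sets of
-- darts at each vertex (the local rotation, read in the fixed orientation),
-- and which alternates between incoming and outgoing arc ends.
record DirectedEmbedding {n m : ℕ} (D : Digraph n m) : Set where
  field
    ρ      : Dart m → Dart m
    ρ⁻     : Dart m → Dart m
    inv₁   : ∀ d → ρ (ρ⁻ d) ≡ d
    inv₂   : ∀ d → ρ⁻ (ρ d) ≡ d
    vert   : ∀ d → dartV D (ρ d) ≡ dartV D d
    altIn  : ∀ a → ∃ λ b → ρ (inn a) ≡ out b
    altOut : ∀ a → ∃ λ b → ρ (out a) ≡ inn b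
    transitive : ∀ d e → dartV D d ≡ dartV D e → ∃ λ k → iter ρ k d ≡ e
open DirectedEmbedding public

-- face permutations on arcs: the proface following arc a leaves head a
-- along the arc after a in the rotation; the antiface along the one before.
proSucc : ∀ {n m} {D : Digraph n m} → DirectedEmbedding D → Fin m → Fin m
proSucc E a = arcOf (ρ E (inn a))

antiSucc : ∀ {n m} {D : Digraph n m} → DirectedEmbedding D → Fin m → Fin m
antiSucc E a = arcOf (ρ⁻ E (inn a))

numProfaces : ∀ {n m} {D : Digraph n m} → DirectedEmbedding D → ℕ
numProfaces E = orbitCount (proSucc E)

numAntifaces : ∀ {n m} {D : Digraph n m} → DirectedEmbedding D → ℕ
numAntifaces E = orbitCount (antiSucc E)

-- total number of faces; with no arcs the (single-vertex) embedding in the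
-- sphere has exactly one face.
numFaces : ∀ {n m} {D : Digraph n m} → DirectedEmbedding D → ℕ
numFaces {m = zero} E = 1
numFaces {m = suc _} E = numProfaces E Data.Nat.+ numAntifaces E

-- twice the genus, from Euler's formula n - m + F = 2 - 2g
twiceGenus : ∀ {n m} {D : Digraph n m} → DirectedEmbedding D → ℤ
twiceGenus {n} {m} E = (+ 2 - + n + + m) - + numFaces E

ProfaceBoundedBy : ∀ {n m} {D : Digraph n m} → DirectedEmbedding D → EulerCircuit D → Set
ProfaceBoundedBy {m = m} E T = ∀ (i : Fin m) → proSucc E (seq T i) ≡ seq T (cyc i)

-- Let next send each arc to its successor on T. For a permutation σ of the arcs that cycles
-- through the arcs entering each vertex, the rotation in which the out-end of next a follows the
-- in-end of a, and the in-end of σ⁻¹ a follows the out-end of next a, is a directed embedding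
-- with T as its only proface and the cycles of next ∘ σ as its antifaces. σ is built from the
-- identity, for which next ∘ σ is the single cycle T, by inserting the arcs entering each vertex
-- one at a time into one cycle; each insertion composes next ∘ σ with a transposition, so it
-- either merges two of its cycles or splits one. The arc after which to insert can be chosen so
-- that a split is always followed by a merge, hence a vertex of in-degree d adds at most one
-- antiface, and only if d is even, i.e. if its degree 2d is divisible by 4. Euler's formula
-- turns this face count into the genus bound.

module Submission where

open import Defs
open import Data.Nat
  using (ℕ; zero; suc; pred; _+_; _%_; _≤_; _<_; z≤n; s≤s; _<?_; _≡ᵇ_; _≤ᵇ_; parity)
open import Data.Nat.ListAction using (sum)
open import Data.Nat.Properties
open import Data.Nat.DivMod using ([m+n]%n≡m%n)
open import Data.Nat.Tactic.RingSolver using (solve-∀)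
open import Data.Fin using (Fin; toℕ)
import Data.Fin as Fin
import Data.Fin.Properties as Fin
open import Data.Bool using (Bool; T; true; false)
open import Data.List using (List; []; _∷_; length; filter; filterᵇ; allFin; upTo; map)
open import Data.Bool.ListAction using (all)
open import Data.List.Properties using (length-removeAt′; filter-notAll)
open import Data.List.Membership.Propositional using (_∈_; _∉_; find; lose)
open import Data.List.Membership.Propositional.Properties
  using (∈-filter⁺; ∈-filter⁻; ∈-upTo⁺; ∈-allFin)
open import Data.List.Relation.Unary.Any as Any using (Any; here; there; _─_)
open import Data.List.Relation.Unary.All as All using (All; []; _∷_)
import Data.List.Relation.Unary.All.Properties as All
open import Data.List.Relation.Unary.Unique.Propositional using (Unique; []; _∷_)
open import Data.List.Relation.Unary.Unique.Propositional.Properties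
  using (allFin⁺; filter⁺; Unique[x∷xs]⇒x∉xs)
open import Data.Parity.Base using (Parity; 0ℙ; 1ℙ; _⁻¹)
open import Data.Parity.Properties using (suc-homo-⁻¹)
open import Data.Product using (∃; ∃₂; _×_; _,_; proj₁; proj₂)
open import Data.Sum using (_⊎_; inj₁; inj₂)
open import Data.Fin.Permutation.Components using (transpose; transpose-inverse)
open import Function using (_∘_; Injective)
open import Relation.Nullary using (¬_; Dec; yes; no; contradiction)
open import Relation.Nullary.Decidable
  using (T?; ⌊_⌋; toWitness; fromWitness; dec-true; dec-false; _⊎-dec_)
open import Relation.Unary.Properties using (∁?)
open import Relation.Binary.PropositionalEquality
import Data.Integer as ℤ
import Data.Integer.Properties as ℤ
open import Data.Integer.Tactic.RingSolver renaming (solve-∀ to ℤ-solve-∀)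

-- Iterates and orbits

module _ {A : Set} (f : A → A) where

  iter-+ : ∀ j k x → iter f (j + k) x ≡ iter f j (iter f k x)
  iter-+ zero    k x = refl
  iter-+ (suc j) k x = cong f (iter-+ j k x)

  iter-sucʳ : ∀ k x → iter f (suc k) x ≡ iter f k (f x)
  iter-sucʳ zero    x = refl
  iter-sucʳ (suc k) x = cong f (iter-sucʳ k x)

  iter-fixed : ∀ {x} → f x ≡ x → ∀ k → iter f k x ≡ x
  iter-fixed fx≡x zero    = refl
  iter-fixed fx≡x (suc k) = trans (cong f (iter-fixed fx≡x k)) fx≡x

  iter-square : ∀ k x → iter (f ∘ f) k x ≡ iter f (k + k) x
  iter-square zero    x = refl
  iter-square (suc k) x = begin
    f (f (iter (f ∘ f) k x))   ≡⟨ cong (f ∘ f) (iter-square k x) ⟩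
    f (f (iter f (k + k) x))   ≡⟨ cong (λ j → iter f (suc j) x) (sym (+-suc k k)) ⟩
    iter f (suc k + suc k) x   ∎
    where open ≡-Reasoning

  iter-mod-period : ∀ {x} p → iter f (suc p) x ≡ x →
                    ∀ k → ∃ λ t → t ≤ p × iter f k x ≡ iter f t x
  iter-mod-period p periodic zero = 0 , z≤n , refl
  iter-mod-period p periodic (suc k) with iter-mod-period p periodic k
  ... | t , t≤p , eq with m≤n⇒m<n∨m≡n t≤p
  ...   | inj₁ t<p  = suc t , t<p , cong f eq
  ...   | inj₂ refl = 0 , z≤n , trans (cong f eq) periodic

iter-conj : ∀ {A B : Set} {f : A → A} {g : B → B} (h : B → A) →
            (∀ x → f (h x) ≡ h (g x)) → ∀ k x → iter f k (h x) ≡ h (iter g k x)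
iter-conj h commute zero    x = refl
iter-conj {f = f} {g} h commute (suc k) x =
  trans (cong f (iter-conj h commute k x)) (commute (iter g k x))

module _ {A : Set} (f : A → A) {P : A → Set} (P? : ∀ x → Dec (P x)) where

  first-hit : ∀ k x → P (iter f k x) →
              ∃ λ j → P (iter f j x) × (∀ i → i < j → ¬ P (iter f i x))
  first-hit k x pk with P? x
  first-hit k       x pk | yes px = 0 , px , λ _ ()
  first-hit zero    x pk | no ¬px = contradiction pk ¬px
  first-hit (suc k) x pk | no ¬px with first-hit k (f x) (subst P (iter-sucʳ f k x) pk)
  ... | j , pj , before = suc j , subst P (sym (iter-sucʳ f j x)) pj , before′
    where
    before′ : ∀ i → i < suc j → ¬ P (iter f i x)
    before′ zero    _         = ¬px
    before′ (suc i) (s≤s i<j) = before i i<j ∘ subst P (iter-sucʳ f i x)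

module _ {A : Set} {f g : A → A} (P : A → Set)
         (closed : ∀ {x} → P x → P (f x)) (agree : ∀ {x} → P x → f x ≡ g x) where

  iter-closed : ∀ {x} → P x → ∀ k → P (iter f k x)
  iter-closed px zero    = px
  iter-closed px (suc k) = closed (iter-closed px k)

  iter-agree : ∀ {x} → P x → ∀ k → iter f k x ≡ iter g k x
  iter-agree px zero    = refl
  iter-agree px (suc k) = trans (agree (iter-closed px k)) (cong g (iter-agree px k))

Reach : ∀ {A : Set} → (A → A) → A → A → Set
Reach f x y = ∃ λ k → iter f k x ≡ y

module _ {A : Set} {f : A → A} where

  reach-refl : ∀ {x} → Reach f x x
  reach-refl = 0 , refl

  reach-≡ : ∀ {x y} → x ≡ y → Reach f x y
  reach-≡ x≡y = 0 , x≡y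

  reach-trans : ∀ {x y z} → Reach f x y → Reach f y z → Reach f x z
  reach-trans {x} (j , refl) (k , refl) = k + j , iter-+ f k j x

  reach-step : ∀ {x y} → Reach f (f x) y → Reach f x y
  reach-step {x} (k , refl) = suc k , iter-sucʳ f k x

  reach-square : ∀ {x y} → Reach (f ∘ f) x y → Reach f x y
  reach-square {x} (k , refl) = k + k , sym (iter-square f k x)

  reach-agree : ∀ {g : A → A} (P : A → Set) → (∀ {x} → P x → P (f x)) →
                (∀ {x} → P x → f x ≡ g x) → ∀ {x y} → P x → Reach f x y → Reach g x y
  reach-agree P closed agree px (k , refl) = k , sym (iter-agree P closed agree px k)

  ¬reach-around : ∀ {x z} j → iter f j (f x) ≡ x → x ≢ z →
                  (∀ i → i < j → iter f i (f x) ≢ z) → ¬ Reach f x z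
  ¬reach-around {x} j returns x≢z avoids (k , refl)
    with iter-mod-period f j (trans (iter-sucʳ f j x) returns) k
  ... | zero  , _       , eq = x≢z (sym eq)
  ... | suc i , i<j , eq = avoids i i<j (trans (sym (iter-sucʳ f i x)) (sym eq))

reach-map : ∀ {A B : Set} {f : A → A} {g : B → B} (h : B → A) →
            (∀ x → f (h x) ≡ h (g x)) → ∀ {x y} → Reach g x y → Reach f (h x) (h y)
reach-map h commute {x} (k , refl) = k , iter-conj h commute k x

-- Permutations of Fin m

module _ {m : ℕ} {f : Fin m → Fin m} (f-injective : Injective _≡_ _≡_ f) where

  iter-injective : ∀ k {x y} → iter f k x ≡ iter f k y → x ≡ y
  iter-injective zero    eq = eq
  iter-injective (suc k) eq = iter-injective k (f-injective eq)

  period : ∀ x → ∃ λ p → p < m × iter f (suc p) x ≡ x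
  period x with Fin.pigeonhole (n<1+n m) (λ (i : Fin (suc m)) → iter f (toℕ i) x)
  ... | i , j , i<j , fⁱx≡fʲx with m≤n⇒∃[o]m+o≡n i<j
  ...   | d , i+1+d≡j = d , d<m , sym (iter-injective (toℕ i) (begin
      iter f (toℕ i) x                   ≡⟨ fⁱx≡fʲx ⟩
      iter f (toℕ j) x                   ≡⟨ cong (λ k → iter f k x) j≡i+1+d ⟩
      iter f (toℕ i + suc d) x           ≡⟨ iter-+ f (toℕ i) (suc d) x ⟩
      iter f (toℕ i) (iter f (suc d) x)  ∎))
    where
    open ≡-Reasoning
    j≡i+1+d : toℕ j ≡ toℕ i + suc d
    j≡i+1+d = trans (sym i+1+d≡j) (sym (+-suc (toℕ i) d))
    d<m : d < m
    d<m = ≤-pred (≤-trans (s≤s (m≤n+m (suc d) (toℕ i)))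
                          (≤-trans (≤-reflexive (cong suc (sym j≡i+1+d))) (Fin.toℕ<n j)))

  reach-bounded : ∀ {x y} → Reach f x y → ∃ λ t → t < m × iter f t x ≡ y
  reach-bounded {x} (k , refl) with period x
  ... | p , p<m , periodic with iter-mod-period f p periodic k
  ...   | t , t≤p , eq = t , ≤-<-trans t≤p p<m , sym eq

  reach-sym : ∀ {x y} → Reach f x y → Reach f y x
  reach-sym {x} (k , refl) with period x
  ... | p , _ , periodic with iter-mod-period f p periodic k
  ...   | t , t≤p , eq with m≤n⇒∃[o]m+o≡n t≤p
  ...     | d , t+d≡p = suc d , (begin
      iter f (suc d) (iter f k x)  ≡⟨ cong (iter f (suc d)) eq ⟩
      iter f (suc d) (iter f t x)  ≡⟨ iter-+ f (suc d) t x ⟨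
      iter f (suc d + t) x         ≡⟨ cong (λ j → iter f (suc j) x) (trans (+-comm d t) t+d≡p) ⟩
      iter f (suc p) x             ≡⟨ periodic ⟩
      x                            ∎)
    where open ≡-Reasoning

  reach? : ∀ x y → Dec (Reach f x y)
  reach? x y with Fin.any? (λ (t : Fin m) → iter f (toℕ t) x Fin.≟ y)
  ... | yes (t , eq) = yes (toℕ t , eq)
  ... | no ∄t = no λ r → let t , t<m , eq = reach-bounded r in
      ∄t (Fin.fromℕ< t<m , trans (cong (λ k → iter f k x) (Fin.toℕ-fromℕ< t<m)) eq)

  inverse : Fin m → Fin m
  inverse x = iter f (proj₁ (period x)) x

  inverseʳ : ∀ x → f (inverse x) ≡ x
  inverseʳ x = proj₂ (proj₂ (period x))

  inverseˡ : ∀ x → inverse (f x) ≡ x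
  inverseˡ x = f-injective (inverseʳ (f x))

  reach-inverse : ∀ {x y} → Reach f x y → Reach inverse y x
  reach-inverse {x} (k , refl) = k , undo k x
    where
    undo : ∀ k x → iter inverse k (iter f k x) ≡ x
    undo zero    x = refl
    undo (suc k) x = trans (iter-sucʳ inverse k (f (iter f k x)))
                           (trans (cong (iter inverse k) (inverseˡ (iter f k x))) (undo k x))

∈-─⁺ : ∀ {A : Set} {a b : A} {ys} (p : a ∈ ys) → b ∈ ys → b ≢ a → b ∈ (ys ─ p)
∈-─⁺ (here refl) (here refl)  b≢a = contradiction refl b≢a
∈-─⁺ (here refl) (there b∈ys) b≢a = b∈ys
∈-─⁺ (there p)   (here refl)  b≢a = here refl
∈-─⁺ (there p)   (there b∈ys) b≢a = there (∈-─⁺ p b∈ys b≢a)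

injectiveOn⇒length≤ : ∀ {A B : Set} {xs : List A} {ys : List B} (h : A → B) → Unique xs →
                      (∀ {x} → x ∈ xs → h x ∈ ys) →
                      (∀ {x x′} → x ∈ xs → x′ ∈ xs → h x ≡ h x′ → x ≡ x′) →
                      length xs ≤ length ys
injectiveOn⇒length≤ h [] maps injective = z≤n
injectiveOn⇒length≤ {xs = x ∷ xs} {ys} h (x≢xs ∷ unique) maps injective =
  subst (suc (length xs) ≤_) (sym (length-removeAt′ ys (Any.index hx∈ys)))
    (s≤s (injectiveOn⇒length≤ h unique
      (λ x′∈xs → ∈-─⁺ hx∈ys (maps (there x′∈xs)) λ hx′≡hx →
         All.lookup x≢xs x′∈xs (sym (injective (there x′∈xs) (here refl) hx′≡hx)))
      (λ x∈xs x′∈xs → injective (there x∈xs) (there x′∈xs))))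
  where hx∈ys = maps (here refl)

Hits : ∀ {m} → (Fin m → Fin m) → List (Fin m) → Set
Hits f R = ∀ x → Any (Reach f x) R

module _ {m : ℕ} {f : Fin m → Fin m} (f-injective : Injective _≡_ _≡_ f) where

  isOrbitMin : Fin m → Bool
  isOrbitMin x = all (λ k → toℕ x ≤ᵇ toℕ (iter f k x)) (upTo m)

  orbitMin-≤ : ∀ {x y} → T (isOrbitMin x) → Reach f x y → toℕ x ≤ toℕ y
  orbitMin-≤ {x} x-min x↝y with reach-bounded f-injective x↝y
  ... | t , t<m , refl = ≤ᵇ⇒≤ _ _ (All.lookup (All.all⁺ _ (upTo m) x-min) (∈-upTo⁺ t<m))

  orbitMin-unique : ∀ {x y} → T (isOrbitMin x) → T (isOrbitMin y) → Reach f x y → x ≡ y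
  orbitMin-unique x-min y-min x↝y = Fin.toℕ-injective
    (≤-antisym (orbitMin-≤ x-min x↝y) (orbitMin-≤ y-min (reach-sym f-injective x↝y)))

  orbitCount≤ : ∀ {R} → Hits f R → orbitCount f ≤ length R
  orbitCount≤ {R} hits = injectiveOn⇒length≤ representative (filter⁺ (T? ∘ isOrbitMin) (allFin⁺ m))
    (λ {x} _ → proj₁ (proj₂ (find (hits x))))
    (λ {x} {x′} x∈ x′∈ same → orbitMin-unique (minimal x∈) (minimal x′∈)
      (reach-trans (to-rep x) (reach-sym f-injective (subst (Reach f x′) (sym same) (to-rep x′)))))
    where
    representative : Fin m → Fin m
    representative x = proj₁ (find (hits x))
    to-rep : ∀ x → Reach f x (representative x)
    to-rep x = proj₂ (proj₂ (find (hits x)))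
    minimal : ∀ {x} → x ∈ filterᵇ isOrbitMin (allFin m) → T (isOrbitMin x)
    minimal x∈ = proj₂ (∈-filter⁻ (T? ∘ isOrbitMin) {xs = allFin m} x∈)

transpose-matchˡ : ∀ {m} (i j : Fin m) → transpose i j i ≡ j
transpose-matchˡ i j rewrite dec-true (i Fin.≟ i) refl = refl

transpose-matchʳ : ∀ {m} (i j : Fin m) → transpose i j j ≡ i
transpose-matchʳ i j with j Fin.≟ i
... | yes j≡i = j≡i
... | no  _   rewrite dec-true (j Fin.≟ j) refl = refl

transpose-other : ∀ {m} {i j k : Fin m} → k ≢ i → k ≢ j → transpose i j k ≡ k
transpose-other {i = i} {j} {k} k≢i k≢j
  rewrite dec-false (k Fin.≟ i) k≢i | dec-false (k Fin.≟ j) k≢j = refl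

transpose-injective : ∀ {m} (i j : Fin m) → Injective _≡_ _≡_ (transpose i j)
transpose-injective i j {a} {b} eq =
  trans (sym (transpose-inverse j i)) (trans (cong (transpose j i) eq) (transpose-inverse j i))

-- β = α ∘ (c y) merges the cycles of c and y when they differ and splits their common cycle
-- otherwise: a β-orbit follows the α-orbit until it meets c or y.
module Transposition {m : ℕ} {α : Fin m → Fin m} (α-injective : Injective _≡_ _≡_ α)
                     {c y : Fin m} (c≢y : c ≢ y) where

  β : Fin m → Fin m
  β = α ∘ transpose c y

  β-injective : Injective _≡_ _≡_ β
  β-injective = transpose-injective c y ∘ α-injective

  β-c : β c ≡ α y
  β-c = cong α (transpose-matchˡ c y)

  β-y : β y ≡ α c
  β-y = cong α (transpose-matchʳ c y)

  Pivot : Fin m → Set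
  Pivot x = x ≡ c ⊎ x ≡ y

  pivot? : ∀ x → Dec (Pivot x)
  pivot? x = (x Fin.≟ c) ⊎-dec (x Fin.≟ y)

  β-agrees : ∀ {x} → ¬ Pivot x → β x ≡ α x
  β-agrees ¬pivot = cong α (transpose-other (¬pivot ∘ inj₁) (¬pivot ∘ inj₂))

  β-follows-α : ∀ {x j} → (∀ i → i < j → ¬ Pivot (iter α i x)) →
                ∀ i → i ≤ j → iter β i x ≡ iter α i x
  β-follows-α avoid zero    _   = refl
  β-follows-α avoid (suc i) i<j =
    trans (cong β (β-follows-α avoid i (<⇒≤ i<j))) (β-agrees (avoid i i<j))

  β-lands : ∀ {P : Fin m → Set} → (∀ x → Dec (P x)) → ∀ {x z} → Reach α x z → P z →
            ∃ λ w → Reach β x w × Reach α x w × (P w ⊎ Pivot w)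
  β-lands P? {x} (k , refl) pz with first-hit α (λ w → P? w ⊎-dec pivot? w) k x (inj₁ pz)
  ... | j , landing , before =
    iter α j x , (j , β-follows-α (λ i i<j → before i i<j ∘ inj₂) j ≤-refl) , (j , refl) , landing

  hits-β : ∀ {R R′} → Hits α R → (∀ {w} → w ∈ R ⊎ Pivot w → Any (Reach β w) R′) → Hits β R′
  hits-β {R} hits land x with find (hits x)
  ... | r , r∈R , x↝r with β-lands (λ w → Any.any? (w Fin.≟_) R) x↝r r∈R
  ...   | w , x↝w , _ , landing = Any.map (reach-trans x↝w) (land landing)

  private
    notFrom : Fin m → List (Fin m) → List (Fin m)
    notFrom x = filter (∁? (reach? α-injective x))

    notFrom-shorter : ∀ {x R} → Any (Reach α x) R → length (notFrom x R) < length R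
    notFrom-shorter {x} {R} x↝R = filter-notAll (∁? (reach? α-injective x)) R
                                    (Any.map (λ x↝r x↛r → x↛r x↝r) x↝R)

  module _ (c↛y : ¬ Reach α c y) where

    private
      from-c : ∀ {z} → Reach α c z → Reach β z c
      from-c c↝z with β-lands (Fin._≟ c) (reach-sym α-injective c↝z) refl
      ... | _ , z↝w , _   , inj₁ refl        = z↝w
      ... | _ , z↝w , _   , inj₂ (inj₁ refl) = z↝w
      ... | _ , _   , z↝y , inj₂ (inj₂ refl) = contradiction (reach-trans c↝z z↝y) c↛y

      β-y↝c : Reach β y c
      β-y↝c = reach-step (subst (λ u → Reach β u c) (sym β-y) (from-c (1 , refl)))

      from-y : ∀ {z} → Reach α y z → Reach β z c
      from-y y↝z with β-lands (Fin._≟ y) (reach-sym α-injective y↝z) refl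
      ... | _ , z↝w , _   , inj₁ refl        = reach-trans z↝w β-y↝c
      ... | _ , z↝w , _   , inj₂ (inj₂ refl) = reach-trans z↝w β-y↝c
      ... | _ , _   , z↝c , inj₂ (inj₁ refl) =
        contradiction (reach-sym α-injective (reach-trans y↝z z↝c)) c↛y

    merge-reach : ∀ {z} → Reach α c z ⊎ Reach α y z → Reach β z c
    merge-reach (inj₁ c↝z) = from-c c↝z
    merge-reach (inj₂ y↝z) = from-y y↝z

    merge-hits : ∀ {R} → Hits α R → ∃ λ R′ → Hits β R′ × length R′ < length R
    merge-hits {R} hits =
      c ∷ notFrom y (notFrom c R) , hits-β hits land ,
      ≤-trans (s≤s (notFrom-shorter y↝notFrom-c)) (notFrom-shorter (hits c))
      where
      y↝notFrom-c : Any (Reach α y) (notFrom c R)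
      y↝notFrom-c with find (hits y)
      ... | r , r∈R , y↝r =
        lose (∈-filter⁺ _ r∈R (λ c↝r → c↛y (reach-trans c↝r (reach-sym α-injective y↝r)))) y↝r
      land : ∀ {w} → w ∈ R ⊎ Pivot w → Any (Reach β w) (c ∷ notFrom y (notFrom c R))
      land (inj₂ (inj₁ w≡c)) = here (reach-≡ w≡c)
      land (inj₂ (inj₂ refl)) = here (merge-reach (inj₂ reach-refl))
      land {w} (inj₁ w∈R) with reach? α-injective c w | reach? α-injective y w
      ... | yes c↝w | _       = here (merge-reach (inj₁ c↝w))
      ... | no _    | yes y↝w = here (merge-reach (inj₂ y↝w))
      ... | no c↛w  | no y↛w  =
        there (Any.map reach-≡ (∈-filter⁺ _ (∈-filter⁺ _ w∈R c↛w) y↛w))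

  module _ (c↝y : Reach α c y) where

    split-reach : ∀ {z} → Reach α c z → Reach β z c ⊎ Reach β z y
    split-reach c↝z with β-lands (Fin._≟ c) (reach-sym α-injective c↝z) refl
    ... | _ , z↝w , _ , inj₁ refl        = inj₁ z↝w
    ... | _ , z↝w , _ , inj₂ (inj₁ refl) = inj₁ z↝w
    ... | _ , z↝w , _ , inj₂ (inj₂ refl) = inj₂ z↝w

    -- Follow α from α y to the first of c, y: meeting y first would close an α-cycle through y
    -- avoiding c; meeting c first closes the β-cycle of c before it can reach y.
    split-separates : ¬ Reach β c y
    split-separates with reach-trans (reach-sym α-injective (1 , refl)) (reach-sym α-injective c↝y)
    ... | k , αy↝c with first-hit α pivot? k (α y) (inj₁ αy↝c)
    ...   | j , inj₂ hit-y , before =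
      contradiction (reach-sym α-injective c↝y)
        (¬reach-around j hit-y (c≢y ∘ sym) (λ i i<j → before i i<j ∘ inj₁))
    ...   | j , inj₁ hit-c , before =
      ¬reach-around j (trans (β-from-c j ≤-refl) hit-c) c≢y
        (λ i i<j eq → before i i<j (inj₂ (trans (sym (β-from-c i (<⇒≤ i<j))) eq)))
      where
      β-from-c : ∀ i → i ≤ j → iter β i (β c) ≡ iter α i (α y)
      β-from-c i i≤j = trans (cong (iter β i) β-c) (β-follows-α before i i≤j)

    split-hits : ∀ {R} → Hits α R → ∃ λ R′ → Hits β R′ × length R′ ≤ suc (length R)
    split-hits {R} hits = c ∷ y ∷ notFrom c R , hits-β hits land , s≤s (notFrom-shorter (hits c))
      where
      land : ∀ {w} → w ∈ R ⊎ Pivot w → Any (Reach β w) (c ∷ y ∷ notFrom c R)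
      land (inj₂ (inj₁ w≡c)) = here (reach-≡ w≡c)
      land (inj₂ (inj₂ w≡y)) = there (here (reach-≡ w≡y))
      land {w} (inj₁ w∈R) with reach? α-injective c w
      ... | no c↛w  = there (there (Any.map reach-≡ (∈-filter⁺ _ w∈R c↛w)))
      ... | yes c↝w with split-reach c↝w
      ...   | inj₁ w↝c = here w↝c
      ...   | inj₂ w↝y = there (here w↝y)

-- Local rotations

fiber : ∀ {n m} → (Fin m → Fin n) → Fin n → List (Fin m)
fiber {m = m} f v = filterᵇ (λ a → ⌊ f a Fin.≟ v ⌋) (allFin m)

module _ {n m : ℕ} (f : Fin m → Fin n) where

  fiber-unique : ∀ v → Unique (fiber f v)
  fiber-unique v = filter⁺ (λ a → T? ⌊ f a Fin.≟ v ⌋) (allFin⁺ m)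

  ∈-fiber⁺ : ∀ {v a} → f a ≡ v → a ∈ fiber f v
  ∈-fiber⁺ {v} {a} fa≡v = ∈-filter⁺ (λ a → T? ⌊ f a Fin.≟ v ⌋) (∈-allFin a) (fromWitness fa≡v)

  ∈-fiber⁻ : ∀ {v a} → a ∈ fiber f v → f a ≡ v
  ∈-fiber⁻ {v} a∈ = toWitness (proj₂ (∈-filter⁻ (λ a → T? ⌊ f a Fin.≟ v ⌋) {xs = allFin m} a∈))

iter-⁻¹-parity : ∀ k → iter _⁻¹ k 0ℙ ≡ parity k
iter-⁻¹-parity zero    = refl
iter-⁻¹-parity (suc k) = trans (cong _⁻¹ (iter-⁻¹-parity k)) (suc-homo-⁻¹ (suc k))

excess : Parity → ℕ
excess 0ℙ = 0
excess 1ℙ = 1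

-- 1 if the fiber has a positive even number of elements, 0 otherwise
surplus : ∀ {n m} → (Fin m → Fin n) → Fin n → ℕ
surplus f v = excess (parity (pred (length (fiber f v))))

module LocalRotations {n m : ℕ} {next : Fin m → Fin m} (next-injective : Injective _≡_ _≡_ next)
                      (class : Fin m → Fin n) where

  -- Instead of counting the cycles of next ∘ σ we keep a list meeting all of them.
  record Rotation : Set where
    field
      σ           : Fin m → Fin m
      σ-injective : Injective _≡_ _≡_ σ
      σ-class     : ∀ a → class (σ a) ≡ class a
      reps        : List (Fin m)
      reps-hit    : Hits (next ∘ σ) reps
  open Rotation

  faces-injective : (r : Rotation) → Injective _≡_ _≡_ (next ∘ σ r)
  faces-injective r = σ-injective r ∘ next-injective

  transpose-class : ∀ {c y} → class c ≡ class y → ∀ a → class (transpose c y a) ≡ class a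
  transpose-class {c} {y} same a = by-cases (a Fin.≟ c) (a Fin.≟ y)
    where
    by-cases : Dec (a ≡ c) → Dec (a ≡ y) → class (transpose c y a) ≡ class a
    by-cases (yes refl) _          = trans (cong class (transpose-matchˡ c y)) (sym same)
    by-cases (no _)     (yes refl) = trans (cong class (transpose-matchʳ c y)) same
    by-cases (no a≢c)   (no a≢y)   = cong class (transpose-other a≢c a≢y)

  transposed : (r : Rotation) {c y : Fin m} → class c ≡ class y → c ≢ y →
               (R : List (Fin m)) → Hits (next ∘ σ r ∘ transpose c y) R → Rotation
  transposed r {c} {y} same c≢y R hits = record
    { σ           = σ r ∘ transpose c y
    ; σ-injective = Transposition.β-injective (σ-injective r) c≢y
    ; σ-class     = λ a → trans (σ-class r (transpose c y a)) (transpose-class same a)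
    ; reps        = R
    ; reps-hit    = hits }

  module Insertion (v : Fin n) (r₀ : Rotation) where

    Done : List (Fin m) → Fin m → Set
    Done pending a = class a ≡ v × a ∉ pending

    record Progress (pending : List (Fin m)) : Set where
      field
        rot           : Rotation
        unchanged     : ∀ a → class a ≢ v → σ rot a ≡ σ r₀ a
        pending-fixed : ∀ {a} → a ∈ pending → σ rot a ≡ a
        done-cyclic   : ∀ {a b} → Done pending a → Done pending b → Reach (σ rot) a b
    open Progress

    Separated : ∀ {pending} → Progress pending → Set
    Separated {pending} P =
      ∃₂ λ c₁ c₂ → Done pending c₁ × Done pending c₂ × ¬ Reach (next ∘ σ (rot P)) c₁ c₂

    module _ {y : Fin m} {pending : List (Fin m)} (y-class : class y ≡ v)
             (y∉pending : y ∉ pending) (P : Progress (y ∷ pending))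
             {c : Fin m} (c-done : Done (y ∷ pending) c) where

      private
        r = rot P
        c≢y : c ≢ y
        c≢y c≡y = proj₂ c-done (here c≡y)

      open Transposition (faces-injective r) c≢y

      inserted : (R : List (Fin m)) → Hits β R → Progress pending
      inserted R hits = record
        { rot           = r′
        ; unchanged     = λ a a∉v →
            trans (cong (σ r) (transpose-other (a∉v ∘ class-c) (a∉v ∘ class-y))) (unchanged P a a∉v)
        ; pending-fixed = λ a∈ →
            trans (cong (σ r) (transpose-other (λ { refl → proj₂ c-done (there a∈) })
                                               (λ { refl → y∉pending a∈ })))
                  (pending-fixed P (there a∈))
        ; done-cyclic   = λ a-done b-done →
            reach-trans (to-c a-done) (reach-sym (σ-injective r′) (to-c b-done)) }
        where
        r′ = transposed r (trans (proj₁ c-done) (sym y-class)) c≢y R hits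
        class-c : ∀ {a} → a ≡ c → class a ≡ v
        class-c refl = proj₁ c-done
        class-y : ∀ {a} → a ≡ y → class a ≡ v
        class-y refl = y-class
        c↛y : ¬ Reach (σ r) c y
        c↛y (k , σᵏc≡y) = c≢y (iter-injective (σ-injective r) k
                                 (trans σᵏc≡y (sym (iter-fixed (σ r) (pending-fixed P (here refl)) k))))
        -- y is a fixed point of σ, so inserting it after c merges the σ-cycles of c and y.
        to-c : ∀ {a} → Done pending a → Reach (σ r′) a c
        to-c {a} (a-class , a∉pending) with a Fin.≟ y
        ... | yes refl = Transposition.merge-reach (σ-injective r) c≢y c↛y (inj₂ reach-refl)
        ... | no a≢y   = Transposition.merge-reach (σ-injective r) c≢y c↛y
                           (inj₁ (done-cyclic P c-done (a-class , λ { (here a≡y) → a≢y a≡y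
                                                                     ; (there a∈) → a∉pending a∈ })))

      merged : ¬ Reach (next ∘ σ r) c y →
               ∃ λ (P′ : Progress pending) → length (reps (rot P′)) < length (reps r)
      merged c↛y with merge-hits c↛y (reps-hit r)
      ... | R , hits , shorter = inserted R hits , shorter

      split : Reach (next ∘ σ r) c y →
              ∃ λ (P′ : Progress pending) →
                length (reps (rot P′)) ≤ suc (length (reps r)) × Separated P′
      split c↝y with split-hits c↝y (reps-hit r)
      ... | R , hits , longer =
        inserted R hits , longer ,
        c , y , (proj₁ c-done , proj₂ c-done ∘ there) , (y-class , y∉pending) , split-separates c↝y

    B : ℕ
    B = length (reps r₀)

    -- Bounds on the number of representatives after an even (0ℙ) or odd (1ℙ) number of insertions.
    Balance : ∀ {pending} → Parity → Progress pending → Set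
    Balance 0ℙ P = length (reps (rot P)) ≤ B
    Balance 1ℙ P = length (reps (rot P)) < B ⊎ (length (reps (rot P)) ≤ suc B × Separated P)

    balance-bound : ∀ {pending} p (P : Progress pending) → Balance p P →
                    length (reps (rot P)) ≤ B + excess p
    balance-bound 0ℙ P bal               = ≤-trans bal (≤-reflexive (sym (+-identityʳ B)))
    balance-bound 1ℙ P (inj₁ below)      = ≤-trans (<⇒≤ below) (m≤m+n B 1)
    balance-bound 1ℙ P (inj₂ (bound , _)) = ≤-trans bound (≤-reflexive (+-comm 1 B))

    -- A split leaves two done arcs on different face cycles, and the next arc cannot lie on both,
    -- so a split is always followed by a merge.
    insertNext : ∀ {y pending} p → class y ≡ v → y ∉ pending → ∀ {d} → Done (y ∷ pending) d →
              (P : Progress (y ∷ pending)) → Balance p P →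
              ∃ λ (P′ : Progress pending) → Balance (p ⁻¹) P′
    insertNext {y} 0ℙ y-class y∉ {d} d-done P bal = even (reach? (faces-injective (rot P)) d y)
      where
      even : Dec (Reach (next ∘ σ (rot P)) d y) → ∃ λ (P′ : Progress _) → Balance 1ℙ P′
      even (no d↛y) = let P′ , shorter = merged y-class y∉ P d-done d↛y in
                      P′ , inj₁ (<-≤-trans shorter bal)
      even (yes d↝y) = let P′ , longer , separated = split y-class y∉ P d-done d↝y in
                       P′ , inj₂ (≤-trans longer (s≤s bal) , separated)
    insertNext {y} 1ℙ y-class y∉ {d} d-done P (inj₁ below) = odd (reach? (faces-injective (rot P)) d y)
      where
      odd : Dec (Reach (next ∘ σ (rot P)) d y) → ∃ λ (P′ : Progress _) → Balance 0ℙ P′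
      odd (no d↛y) = let P′ , shorter = merged y-class y∉ P d-done d↛y in
                     P′ , <⇒≤ (<-trans shorter below)
      odd (yes d↝y) = let P′ , longer , _ = split y-class y∉ P d-done d↝y in
                      P′ , ≤-trans longer below
    insertNext {y} 1ℙ y-class y∉ d-done P (inj₂ (bound , c₁ , c₂ , c₁-done , c₂-done , c₁↛c₂)) =
      let P′ , shorter = merge-with (reach? (faces-injective (rot P)) c₁ y) in
      P′ , ≤-pred (≤-trans shorter bound)
      where
      merge-with : Dec (Reach (next ∘ σ (rot P)) c₁ y) →
                   ∃ λ (P′ : Progress _) → length (reps (rot P′)) < length (reps (rot P))
      merge-with (no c₁↛y)  = merged y-class y∉ P c₁-done c₁↛y
      merge-with (yes c₁↝y) = merged y-class y∉ P c₂-done λ c₂↝y →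
        c₁↛c₂ (reach-trans c₁↝y (reach-sym (faces-injective (rot P)) c₂↝y))

    insertAll : ∀ {pending} p → Unique pending → All (λ a → class a ≡ v) pending →
          ∀ {d} → Done pending d → (P : Progress pending) → Balance p P →
          ∃ λ (P′ : Progress []) → Balance (iter _⁻¹ (length pending) p) P′
    insertAll p [] [] d-done P bal = P , bal
    insertAll {y ∷ pending} p (y∉ ∷ unique) (y-class ∷ classes) {d} d-done P bal =
      let P′ , bal′ = insertNext p y-class (Unique[x∷xs]⇒x∉xs (y∉ ∷ unique)) d-done P bal
          P″ , bal″ = insertAll (p ⁻¹) unique classes (proj₁ d-done , proj₂ d-done ∘ there) P′ bal′
      in P″ , subst (λ q → Balance q P″) (sym (iter-sucʳ _⁻¹ (length pending) p)) bal″

  record RotatedAt (v : Fin n) (r₀ : Rotation) (k : ℕ) : Set where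
    field
      rot       : Rotation
      unchanged : ∀ a → class a ≢ v → σ rot a ≡ σ r₀ a
      cyclic    : ∀ {a b} → class a ≡ v → class b ≡ v → Reach (σ rot) a b
      bound     : length (reps rot) ≤ length (reps r₀) + k

  rotateAt : ∀ v (r₀ : Rotation) → (∀ {a} → class a ≡ v → σ r₀ a ≡ a) →
             (L : List (Fin m)) → Unique L → (∀ {a} → a ∈ L → class a ≡ v) →
             (∀ {a} → class a ≡ v → a ∈ L) → RotatedAt v r₀ (excess (parity (pred (length L))))
  rotateAt v r₀ fixes [] _ _ complete = record
    { rot       = r₀
    ; unchanged = λ _ _ → refl
    ; cyclic    = λ a-class _ → contradiction (complete a-class) λ ()
    ; bound     = m≤m+n _ 0 }
  rotateAt v r₀ fixes (c₀ ∷ rest) unique@(_ ∷ rest-unique) sound complete =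
    let P , bal = insertAll 0ℙ rest-unique (All.tabulate (sound ∘ there)) c₀-done initial ≤-refl in
    record
      { rot       = Progress.rot P
      ; unchanged = Progress.unchanged P
      ; cyclic    = λ a-class b-class → Progress.done-cyclic P (a-class , λ ()) (b-class , λ ())
      ; bound     = subst (λ q → length (reps (Progress.rot P)) ≤ B + excess q)
                          (iter-⁻¹-parity (length rest)) (balance-bound _ P bal) }
    where
    open Insertion v r₀
    c₀-done : Done rest c₀
    c₀-done = sound (here refl) , Unique[x∷xs]⇒x∉xs unique
    only-c₀ : ∀ {a} → Done rest a → a ≡ c₀
    only-c₀ (a-class , a∉rest) with complete a-class
    ... | here a≡c₀    = a≡c₀
    ... | there a∈rest = contradiction a∈rest a∉rest
    initial : Progress rest
    initial = record
      { rot           = r₀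
      ; unchanged     = λ _ _ → refl
      ; pending-fixed = λ a∈rest → fixes (sound (there a∈rest))
      ; done-cyclic   = λ a-done b-done → reach-≡ (trans (only-c₀ a-done) (sym (only-c₀ b-done))) }

  record Partial (K : ℕ) (todo : List (Fin n)) : Set where
    field
      rot         : Rotation
      todo-fixed  : ∀ {a} → class a ∈ todo → σ rot a ≡ a
      done-cyclic : ∀ {a b} → class a ≡ class b → class a ∉ todo → Reach (σ rot) a b
      bound       : length (reps rot) + sum (map (surplus class) todo) ≤ K

  rotateAll : ∀ {K} todo → Unique todo → Partial K todo → Partial K []
  rotateAll []         _                 P = P
  rotateAll (v ∷ todo) (v≢todo ∷ unique) P = rotateAll todo unique (record
    { rot         = RotatedAt.rot R
    ; todo-fixed  = λ a∈todo →
        trans (RotatedAt.unchanged R _ (λ a-v → v∉todo (subst (_∈ todo) a-v a∈todo)))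
              (Partial.todo-fixed P (there a∈todo))
    ; done-cyclic = done-cyclic
    ; bound       = ≤-trans (+-monoˡ-≤ _ (RotatedAt.bound R))
                            (≤-trans (≤-reflexive (+-assoc (length (reps r)) (surplus class v) _))
                                     (Partial.bound P)) })
    where
    r = Partial.rot P
    R = rotateAt v r (λ a-v → Partial.todo-fixed P (here a-v)) (fiber class v) (fiber-unique class v)
                 (∈-fiber⁻ class) (∈-fiber⁺ class)
    v∉todo : v ∉ todo
    v∉todo = Unique[x∷xs]⇒x∉xs (v≢todo ∷ unique)
    done-cyclic : ∀ {a b} → class a ≡ class b → class a ∉ todo → Reach (σ (RotatedAt.rot R)) a b
    done-cyclic {a} same a∉todo with class a Fin.≟ v
    ... | yes a-v = RotatedAt.cyclic R a-v (trans (sym same) a-v)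
    ... | no a≢v  = reach-agree (λ x → class x ≡ class a) (λ {x} x-a → trans (σ-class r x) x-a)
                      (λ x-a → sym (RotatedAt.unchanged R _ (a≢v ∘ trans (sym x-a))))
                      refl (Partial.done-cyclic P same λ { (here a-v)  → a≢v a-v
                                                          ; (there a∈) → a∉todo a∈ })

  localRotation : ∀ {R} → Hits next R →
                  ∃ λ (r : Rotation) → (∀ {a b} → class a ≡ class b → Reach (σ r) a b)
                                     × length (reps r) ≤ length R + sum (map (surplus class) (allFin n))
  localRotation {R} hits =
    let P = rotateAll (allFin n) (allFin⁺ n) initial in
    Partial.rot P , (λ same → Partial.done-cyclic P same λ ()) ,
    ≤-trans (≤-reflexive (sym (+-identityʳ _))) (Partial.bound P)
    where
    initial : Partial (length R + sum (map (surplus class) (allFin n))) (allFin n)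
    initial = record
      { rot         = record { σ = λ a → a ; σ-injective = λ eq → eq ; σ-class = λ _ → refl
                             ; reps = R ; reps-hit = hits }
      ; todo-fixed  = λ _ → refl
      ; done-cyclic = λ {a} _ a∉ → contradiction (∈-allFin (class a)) a∉
      ; bound       = ≤-refl }

-- The successor of an arc on an euler circuit

cyc-cases : ∀ {k} (i : Fin (suc k)) →
            toℕ (cyc i) ≡ suc (toℕ i) ⊎ (suc (toℕ i) ≡ suc k × cyc i ≡ Fin.zero)
cyc-cases {k} i with suc (toℕ i) <? suc k
... | yes i+1<k+1 = inj₁ (Fin.toℕ-fromℕ< i+1<k+1)
... | no  i+1≮k+1 = inj₂ (≤-antisym (Fin.toℕ<n i) (≮⇒≥ i+1≮k+1) , refl)

cyc-injective : ∀ {m} → Injective _≡_ _≡_ (cyc {m})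
cyc-injective {suc k} {i} {j} eq with cyc-cases i | cyc-cases j
... | inj₁ i′ | inj₁ j′ =
  Fin.toℕ-injective (suc-injective (trans (sym i′) (trans (cong toℕ eq) j′)))
... | inj₂ (i-last , _) | inj₂ (j-last , _) =
  Fin.toℕ-injective (suc-injective (trans i-last (sym j-last)))
... | inj₁ i′ | inj₂ (_ , j′) =
  contradiction (trans (sym i′) (trans (cong toℕ eq) (cong toℕ j′))) λ ()
... | inj₂ (_ , i′) | inj₁ j′ =
  contradiction (trans (sym j′) (trans (cong toℕ (sym eq)) (cong toℕ i′))) λ ()

toℕ-iter-cyc : ∀ {k} t → t < suc k → toℕ (iter cyc t (Fin.zero {k})) ≡ t
toℕ-iter-cyc zero    _   = refl
toℕ-iter-cyc (suc t) t<k+1 with cyc-cases (iter cyc t Fin.zero)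
... | inj₁ next-t     = trans next-t (cong suc (toℕ-iter-cyc t (<⇒≤ t<k+1)))
... | inj₂ (last , _) = contradiction (trans (cong suc (sym (toℕ-iter-cyc t (<⇒≤ t<k+1)))) last)
                                      (<⇒≢ t<k+1)

cyc-reaches-zero : ∀ {k} (i : Fin (suc k)) → Reach cyc i Fin.zero
cyc-reaches-zero i = reach-sym cyc-injective
  (toℕ i , Fin.toℕ-injective (toℕ-iter-cyc (toℕ i) (Fin.toℕ<n i)))

module Successor {n m : ℕ} {D : Digraph n m} (T : EulerCircuit D) where

  seq-injective : Injective _≡_ _≡_ (seq T)
  seq-injective = seq-inj T _ _

  position : Fin m → Fin m
  position = inverse seq-injective

  next : Fin m → Fin m
  next a = seq T (cyc (position a))

  next-injective : Injective _≡_ _≡_ next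
  next-injective {a} {b} eq =
    trans (sym (inverseʳ seq-injective a))
          (trans (cong (seq T) (cyc-injective (seq-injective eq))) (inverseʳ seq-injective b))

  next-seq : ∀ i → next (seq T i) ≡ seq T (cyc i)
  next-seq i = cong (seq T ∘ cyc) (inverseˡ seq-injective i)

  tail-next : ∀ a → tail D (next a) ≡ head D a
  tail-next a = trans (sym (consec T (position a))) (cong (head D) (inverseʳ seq-injective a))

  previous : Fin m → Fin m
  previous = inverse next-injective

  head-previous : ∀ b → head D (previous b) ≡ tail D b
  head-previous b = trans (sym (tail-next (previous b))) (cong (tail D) (inverseʳ next-injective b))

  outdegree≡indegree : ∀ v → length (fiber (tail D) v) ≡ length (fiber (head D) v)
  outdegree≡indegree v = ≤-antisym
    (injectiveOn⇒length≤ previous (fiber-unique (tail D) v)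
      (λ b∈ → ∈-fiber⁺ (head D) (trans (head-previous _) (∈-fiber⁻ (tail D) b∈)))
      (λ _ _ eq → trans (sym (inverseʳ next-injective _))
                        (trans (cong next eq) (inverseʳ next-injective _))))
    (injectiveOn⇒length≤ next (fiber-unique (head D) v)
      (λ a∈ → ∈-fiber⁺ (tail D) (trans (tail-next _) (∈-fiber⁻ (head D) a∈)))
      (λ _ _ → next-injective))

  degree≡2*indegree : ∀ v → degree D v ≡ length (fiber (head D) v) + length (fiber (head D) v)
  degree≡2*indegree v = cong (_+ length (fiber (head D) v)) (outdegree≡indegree v)


next-hits : ∀ {n m} {D : Digraph n m} (T : EulerCircuit D) →
            ∃ λ R → length R ≤ 1 × Hits (Successor.next T) R
next-hits {m = zero}  T = [] , z≤n , λ ()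
next-hits {m = suc k} T = seq T Fin.zero ∷ [] , s≤s z≤n , λ a → here
  (subst (λ x → Reach next x _) (inverseʳ seq-injective a)
         (reach-map (seq T) next-seq (cyc-reaches-zero (position a))))
  where open Successor T

excess≤1 : ∀ p → excess p ≤ 1
excess≤1 0ℙ = z≤n
excess≤1 1ℙ = ≤-refl

excess-parity-pred : ∀ d → ((d + d) % 4 ≡ᵇ 0) ≡ false → excess (parity (pred d)) ≡ 0
excess-parity-pred 0 _ = refl
excess-parity-pred 1 _ = refl
excess-parity-pred 2 ()
excess-parity-pred (suc (suc (suc d))) not0 =
  excess-parity-pred (suc d) (trans (cong (_≡ᵇ 0) (sym mod4)) not0)
  where
  shift : ∀ d → suc (suc (suc d)) + suc (suc (suc d)) ≡ (suc d + suc d) + 4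
  shift = solve-∀
  mod4 : (suc (suc (suc d)) + suc (suc (suc d))) % 4 ≡ (suc d + suc d) % 4
  mod4 = trans (cong (_% 4) (shift d)) ([m+n]%n≡m%n (suc d + suc d) 4)

sum-surplus≤numDeg0mod4 : ∀ {n m} {D : Digraph n m} → EulerCircuit D →
                          sum (map (surplus (head D)) (allFin n)) ≤ numDeg0mod4 D
sum-surplus≤numDeg0mod4 {n} {D = D} T = go (allFin n)
  where
  open Successor T
  go : ∀ vs → sum (map (surplus (head D)) vs) ≤ length (filterᵇ (λ v → (degree D v % 4) ≡ᵇ 0) vs)
  go []       = z≤n
  go (v ∷ vs) with (degree D v % 4) ≡ᵇ 0 in deg-mod4
  ... | true  = +-mono-≤ (excess≤1 _) (go vs)
  ... | false = ≤-trans (≤-reflexive (cong (_+ _) no-surplus)) (go vs)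
    where
    no-surplus : surplus (head D) v ≡ 0
    no-surplus = excess-parity-pred (length (fiber (head D) v))
                   (trans (cong (λ x → x % 4 ≡ᵇ 0) (sym (degree≡2*indegree v))) deg-mod4)

-- The embedding

module RotationEmbedding {n m : ℕ} {D : Digraph n m} (T : EulerCircuit D)
                         {σ : Fin m → Fin m} (σ-injective : Injective _≡_ _≡_ σ)
                         (σ-head : ∀ a → head D (σ a) ≡ head D a)
                         (σ-cyclic : ∀ {a b} → head D a ≡ head D b → Reach σ a b) where

  open Successor T

  σ⁻¹ : Fin m → Fin m
  σ⁻¹ = inverse σ-injective

  head-σ⁻¹ : ∀ a → head D (σ⁻¹ a) ≡ head D a
  head-σ⁻¹ a = trans (sym (σ-head (σ⁻¹ a))) (cong (head D) (inverseʳ σ-injective a))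

  rotate : Dart m → Dart m
  rotate (inn a) = out (next a)
  rotate (out b) = inn (σ⁻¹ (previous b))

  rotate⁻¹ : Dart m → Dart m
  rotate⁻¹ (out b) = inn (previous b)
  rotate⁻¹ (inn a) = out (next (σ a))

  rotate²-inn : ∀ a → rotate (rotate (inn a)) ≡ inn (σ⁻¹ a)
  rotate²-inn a = cong (inn ∘ σ⁻¹) (inverseˡ next-injective a)

  reach-inn : ∀ d → ∃ λ a → head D a ≡ dartV D d × Reach rotate d (inn a)
  reach-inn (inn a) = a , refl , reach-refl
  reach-inn (out b) = σ⁻¹ (previous b) , trans (head-σ⁻¹ _) (head-previous b) , (1 , refl)

  reached-from-inn : ∀ d → ∃ λ a → head D a ≡ dartV D d × Reach rotate (inn a) d
  reached-from-inn (inn a) = a , refl , reach-refl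
  reached-from-inn (out b) = previous b , head-previous b , (1 , cong out (inverseʳ next-injective b))

  inn-reach-inn : ∀ {a b} → head D a ≡ head D b → Reach rotate (inn a) (inn b)
  inn-reach-inn same =
    reach-square (reach-map inn rotate²-inn (reach-inverse σ-injective (σ-cyclic (sym same))))

  embedding : DirectedEmbedding D
  embedding = record
    { ρ          = rotate
    ; ρ⁻         = rotate⁻¹
    ; inv₁       = λ { (out b) → cong out (inverseʳ next-injective b)
                     ; (inn a) → cong inn (trans (cong σ⁻¹ (inverseˡ next-injective (σ a)))
                                                 (inverseˡ σ-injective a)) }
    ; inv₂       = λ { (inn a) → cong inn (inverseˡ next-injective a)
                     ; (out b) → cong out (trans (cong next (inverseʳ σ-injective (previous b)))
                                                 (inverseʳ next-injective b)) }
    ; vert       = λ { (inn a) → tail-next a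
                     ; (out b) → trans (head-σ⁻¹ _) (head-previous b) }
    ; altIn      = λ a → next a , refl
    ; altOut     = λ b → σ⁻¹ (previous b) , refl
    ; transitive = λ d e same →
        let a , a-d , d↝a = reach-inn d
            b , b-e , b↝e = reached-from-inn e
        in reach-trans d↝a (reach-trans (inn-reach-inn (trans a-d (trans same (sym b-e)))) b↝e) }

numFaces≤ : ∀ {n m} {D : Digraph n m} (E : DirectedEmbedding D) {ℓ} →
            numProfaces E ≤ 1 → numAntifaces E ≤ suc ℓ → numFaces E ≤ 2 + ℓ
numFaces≤ {m = zero}  E _   _    = s≤s z≤n
numFaces≤ {m = suc _} E pro anti = +-mono-≤ pro anti

twiceGenus≥ : ∀ {n m} {D : Digraph n m} (E : DirectedEmbedding D) ℓ → numFaces E ≤ 2 + ℓ →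
              (ℤ.+ m ℤ.- ℤ.+ n ℤ.- ℤ.+ ℓ) ℤ.≤ twiceGenus E
twiceGenus≥ {n} {m} E ℓ faces = ℤ.≤-trans (ℤ.≤-reflexive (rearrange (ℤ.+ m) (ℤ.+ n) (ℤ.+ ℓ)))
  (ℤ.+-monoʳ-≤ (ℤ.+ 2 ℤ.- ℤ.+ n ℤ.+ ℤ.+ m) (ℤ.neg-mono-≤ (ℤ.+≤+ faces)))
  where
  rearrange : ∀ (m n ℓ : ℤ.ℤ) → m ℤ.- n ℤ.- ℓ ≡ (ℤ.+ 2 ℤ.- n ℤ.+ m) ℤ.- (ℤ.+ 2 ℤ.+ ℓ)
  rearrange = ℤ-solve-∀

fewAntifacesEmbedding : ∀ {n m} {D : Digraph n m} (T : EulerCircuit D) →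
  ∃ λ (E : DirectedEmbedding D) →
    ProfaceBoundedBy E T × numProfaces E ≤ 1 × numAntifaces E ≤ suc (numDeg0mod4 D)
fewAntifacesEmbedding {D = D} T =
  let R₀ , R₀≤1 , R₀-hits = next-hits T
      r , cyclic , bound  = localRotation R₀-hits
      E = RotationEmbedding.embedding T (Rotation.σ-injective r) (Rotation.σ-class r) cyclic
  in E , next-seq , ≤-trans (orbitCount≤ next-injective R₀-hits) R₀≤1 , (begin
    numAntifaces E
      ≤⟨ orbitCount≤ (faces-injective r) (Rotation.reps-hit r) ⟩
    length (Rotation.reps r)
      ≤⟨ bound ⟩
    length R₀ + sum (map (surplus (head D)) (allFin _))
      ≤⟨ +-mono-≤ R₀≤1 (sum-surplus≤numDeg0mod4 T) ⟩
    suc (numDeg0mod4 D) ∎)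
  where
  open Successor T
  open LocalRotations next-injective (head D)
  open ≤-Reasoning

theorem4p4 : ∀ {n m : ℕ} (D : Digraph n m) (ℓ : ℕ) → ℓ ≡ numDeg0mod4 D →
    (T : EulerCircuit D) →
    (∃ λ (E : DirectedEmbedding D) →
        ProfaceBoundedBy E T × numAntifaces E ≤ ℓ + 1)
    × (∃ λ (E : DirectedEmbedding D) →
        (ℤ.+ m ℤ.- ℤ.+ n ℤ.- ℤ.+ ℓ) ℤ.≤ twiceGenus E)
theorem4p4 D ℓ refl T =
  let E , bounded-by-T , profaces , antifaces = fewAntifacesEmbedding T in
  (E , bounded-by-T , ≤-trans antifaces (≤-reflexive (+-comm 1 ℓ))) ,
  (E , twiceGenus≥ E ℓ (numFaces≤ E profaces antifaces))
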